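{- The nim-number of $\mathsf{GEN}(\mathbb{Z}_2)$ is $2$. If $n\ge 3$, then the nim-number of $\mathsf{GEN}(\mathbb{Z}_n)$ is $2$ if $n$ is odd, $1$ if $n\equiv 0\pmod 4$, and $4$ if $n\equiv 2\pmod 4$.
   Context: For a finite group $G$, the achievement game $\mathsf{GEN}(G)$ is the impartial game (normal play) with starting position $\emptyset$, whose positions are $\emptyset$, the subsets $P\subseteq G$ with $\langle P\rangle\neq G$, and the subsets $P$ with $\langle P\rangle=G$ such that $\langle P\setminus\{s\}\rangle\neq G$ for some $s\in P$. If $\langle P\rangle\neq G$ then $\operatorname{Opt}(P)=\{P\cup\{g\}:g\in G\setminus P\}$; if $\langle P\rangle=G$ then $\operatorname{Opt}(P)=\emptyset$. The nim-number is $\operatorname{nim}(P)=\operatorname{mex}\{\operatorname{nim}(Q):Q\in\operatorname{Opt}(P)\}$ ($\operatorname{mex}(A)$ = least nonnegative integer not in $A$), and the nim-number of the game is $\operatorname{nim}(\emptyset)$. $\mathbb{Z}_n$ is the cyclic group of order $n$. -}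

module Defs where

open import Data.Bool using (Bool; true; false; _∨_; _∧_; not; if_then_else_)
open import Data.Nat using (ℕ; zero; suc; _≡ᵇ_)
open import Data.Nat.DivMod using (_mod_)
open import Data.Fin using (Fin; toℕ)
open import Data.Fin.Properties using (_≟_)
open import Data.Fin.Subset using (Subset; ⊥; ⁅_⁆; _∪_)
open import Data.Vec using (Vec; lookup; tabulate; toList)
open import Data.List using (List; []; _∷_; length; map)
open import Data.Bool.ListAction using (any; all)
open import Data.List using (allFin) renaming (filter to lfilter)
open import Relation.Nullary using (does)
open import Function using (_∘_)

-- The cyclic group Z_n, with n = suc m (so that Fin n is inhabited).
-- Elements are Fin (suc m); the operation is addition modulo n.

_⊕_ : ∀ {m} → Fin (suc m) → Fin (suc m) → Fin (suc m)
_⊕_ {m} a b = (toℕ a Data.Nat.+ toℕ b) mod (suc m)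

0ᶻ : ∀ {m} → Fin (suc m)
0ᶻ = Fin.zero

_∈ᵇ_ : ∀ {n} → Fin n → Subset n → Bool
g ∈ᵇ S = lookup S g

elems : ∀ {m} → List (Fin (suc m))
elems = allFin _

step : ∀ {m} → Subset (suc m) → Subset (suc m) → Subset (suc m)
step {m} P S = tabulate λ g →
  (g ∈ᵇ S) ∨ any (λ s → (s ∈ᵇ S) ∧ any (λ p → (p ∈ᵇ P) ∧ does ((s ⊕ p) ≟ g)) elems) elems

iterate : ∀ {A : Set} → ℕ → (A → A) → A → A
iterate zero f x = x
iterate (suc k) f x = f (iterate k f x)

-- ⟨P⟩ : the set of all finite sums of elements of P (the empty sum being 0).
-- In a finite group this is exactly the subgroup generated by P; the chain
-- {0} ⊆ step {0} ⊆ ... stabilises after at most n steps, so n iterations suffice.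
⟨_⟩ : ∀ {m} → Subset (suc m) → Subset (suc m)
⟨_⟩ {m} P = iterate (suc m) (step P) ⁅ 0ᶻ ⁆

generates : ∀ {m} → Subset (suc m) → Bool
generates {m} P = all (λ g → g ∈ᵇ ⟨ P ⟩) elems

_∈ℕ_ : ℕ → List ℕ → Bool
k ∈ℕ xs = any (λ x → k ≡ᵇ x) xs

mexFrom : ℕ → ℕ → List ℕ → ℕ
mexFrom zero    k xs = k
mexFrom (suc f) k xs = if k ∈ℕ xs then mexFrom f (suc k) xs else k

-- the mex is at most length xs, so length xs + 1 search steps suffice
mex : List ℕ → ℕ
mex xs = mexFrom (suc (length xs)) 0 xs

-- The fuel argument bounds the remaining number of moves; started with
-- fuel n at ∅, fuel 0 is only reached at P = G, which is terminal anyway.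

nimF : ∀ {m} → ℕ → Subset (suc m) → ℕ
nimF zero    P = 0
nimF {m} (suc f) P =
  if generates P then 0
  else mex (map (λ g → nimF f (P ∪ ⁅ g ⁆))
                (lfilter (λ g → Relation.Nullary.¬? (Data.Bool._≟_ (g ∈ᵇ P) true)) elems))

-- nim-number of the game GEN(Z_n) (value for n = 0 is a dummy; Z_0 is not finite)
nimGEN : ℕ → ℕ
nimGEN zero    = 0
nimGEN (suc m) = nimF {m} (suc m) ⊥

-- A set P ⊆ ℤ_n generates the subgroup of multiples of d = gcd(n, P), so P is terminal
-- exactly when d = 1, and adding the element 1 always ends the game. Hence every
-- non-terminal position has a nonzero nim-number, and it suffices to guess the
-- nim-numbers of the non-terminal positions as a function of |P| mod 2 and of d, and to
-- check the mex recursion for the guess: every move changes the value, and every smaller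
-- positive value is reached by a move that does not end the game. Moves keeping d exist
-- whenever |P| and the order n/d of ⟨P⟩ have different parity (some multiple of d is then
-- missing from P); for n ≡ 2 (mod 4) and d = 2k with k > 1 odd, adding 2 or k brings the
-- gcd down to 2 or k. The guesses are 2/1 (|P| even/odd) for n odd, 1/2 for 4 ∣ n, and
-- for n ≡ 2 (mod 4) they are 2/1 if d = 2, 1/2 if d is odd, and 4/3 otherwise.
module Submission where

open import Data.Bool as Bool using (Bool; true; false; T; if_then_else_; _∨_; _∧_)
open import Data.Bool.ListAction using (any)
open import Data.Bool.Properties using (T-≡; T-∨; T-∧; ¬-not)
open import Data.Empty using (⊥-elim)
open import Data.Fin as Fin using (Fin; toℕ; fromℕ)
open import Data.Fin.Properties using (toℕ-injective; toℕ-fromℕ<; toℕ-fromℕ; toℕ<n) renaming (_≟_ to _≟ᶠ_)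
open import Data.Fin.Subset using (Subset; ⊥; ⁅_⁆; _∪_; _∈_; _∉_; _⊆_; _⊂_; ∣_∣)
open import Data.Fin.Subset.Properties
  using (_∈?_; _⊂?_; ⊆-antisym; p⊂q⇒∣p∣<∣q∣; ∣p∣≤n; x∈⁅x⁆; x∈⁅y⁆⇒x≡y; x∈p∪q⁻; p⊆p∪q; q⊆p∪q;
         ∪-identityʳ; drop-not-there; ∣p∣≡n⇒p≡⊤; ∈⊤; ∉⊥; ∣⊥∣≡0)
open import Data.List using (List; []; _∷_; length; map; allFin; foldr) renaming (filter to lfilter)
open import Data.List.Membership.Propositional using (lose) renaming (_∈_ to _∈ˡ_; _∉_ to _∉ˡ_)
open import Data.List.Membership.Propositional.Properties
  using (∈-allFin; ∈-map⁺; ∈-map⁻; ∈-filter⁺; ∈-filter⁻)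
open import Data.List.Relation.Unary.All as All using ()
open import Data.List.Relation.Unary.All.Properties using (all⁺; all⁻)
open import Data.List.Relation.Unary.Any as Any using (here; there; satisfied)
open import Data.List.Relation.Unary.Any.Properties using (any⁺; any⁻)
open import Data.Nat
  using (ℕ; zero; suc; _+_; _*_; _∸_; _≤_; _<_; z≤n; s≤s; _≡ᵇ_; NonZero; ≢-nonZero; ≢-nonZero⁻¹; >-nonZero;
         parity)
open import Data.Nat.Properties
  using (_≟_; ≡ᵇ⇒≡; ≡⇒≡ᵇ; ≤-refl; <⇒≤; <⇒≢; <⇒≱; m≤n⇒m≤1+n; m≤n⇒m<n∨m≡n; <-≤-trans; ≤∧≢⇒<; n≢0⇒n>0;
         m<m*n; +-identityʳ; +-suc; +-comm; +-assoc; *-comm; *-assoc; m∸n+n≡m)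
open import Data.Nat.DivMod using (_%_; _mod_; %-distribˡ-+; m%n%n≡m%n; %-remove-+ʳ; m<n⇒m%n≡m; m%n<n)
open import Data.Nat.Divisibility
  using (_∣_; divides; _∣?_; ∣-refl; ∣-trans; ∣-antisym; _∣0; 0∣⇒≡0; ∣1⇒≡1; ∣m∣n⇒∣m+n; ∣m+n∣m⇒∣n; ∣⇒≤;
         m∣m*n; n∣m*n; *-pres-∣; %-presˡ-∣; ∣n∣m%n⇒∣m; n∣m⇒m%n≡0; m%n≡0⇒n∣m)
open import Data.Nat.GCD using (gcd; gcd[m,n]∣m; gcd[m,n]∣n; gcd-greatest; gcd-zeroʳ; gcd-GCD; module Bézout)
open import Data.Parity.Base using (Parity; 0ℙ; 1ℙ; _⁻¹)
open import Data.Parity.Properties using (⁻¹-involutive; suc-homo-⁻¹; *-homo-*)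
open import Data.Product using (Σ; ∃; ∃₂; _×_; _,_; proj₁; proj₂)
open import Data.Sum using (_⊎_; inj₁; inj₂)
open import Data.Vec.Base as Vec using (lookup; tabulate; _∷_)
open import Data.Vec.Properties using ([]=⇒lookup; lookup⇒[]=; lookup∘tabulate; tabulate-cong)
open import Function using (Equivalence; _∘_; mk⇔)
open import Relation.Nullary using (Dec; yes; no; ¬_; ¬?; does)
open import Relation.Nullary.Decidable
  using (toWitness; decidable-stable; dec-true; dec-false; does-⇔; isYes≗does)
open import Relation.Binary.PropositionalEquality

open import Defs

-- The minimal excludant

∈ℕ⇒∈ : ∀ {k xs} → (k ∈ℕ xs) ≡ true → k ∈ˡ xs
∈ℕ⇒∈ {k} {xs} eq = Any.map (λ {x} → ≡ᵇ⇒≡ k x) (any⁻ (k ≡ᵇ_) xs (Equivalence.from T-≡ eq))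

∈⇒∈ℕ : ∀ {k xs} → k ∈ˡ xs → (k ∈ℕ xs) ≡ true
∈⇒∈ℕ {k} k∈xs = Equivalence.to T-≡ (any⁺ (k ≡ᵇ_) (Any.map (λ {x} → ≡⇒≡ᵇ k x) k∈xs))

remove-∈ : ∀ {j} {xs : List ℕ} → j ∈ˡ xs →
           ∃ λ ys → length xs ≡ suc (length ys) × (∀ k → k ∈ˡ xs → k ≢ j → k ∈ˡ ys)
remove-∈ {xs = x ∷ xs} (here refl) = xs , refl , λ
  { k (here refl) k≢j → ⊥-elim (k≢j refl)
  ; k (there k∈xs) _  → k∈xs }
remove-∈ {xs = x ∷ xs} (there j∈xs) with remove-∈ j∈xs
... | ys , len , keep = x ∷ ys , cong suc len , λ
  { k (here refl) _     → here refl
  ; k (there k∈xs) k≢j → there (keep k k∈xs k≢j) }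

below-∈⇒≤-length : ∀ v (xs : List ℕ) → (∀ j → j < v → j ∈ˡ xs) → v ≤ length xs
below-∈⇒≤-length zero    xs below = z≤n
below-∈⇒≤-length (suc v) xs below with remove-∈ (below v ≤-refl)
... | ys , len , keep rewrite len =
  s≤s (below-∈⇒≤-length v ys λ j j<v → keep j (below j (m≤n⇒m≤1+n j<v)) (<⇒≢ j<v))

mexFrom-≡ : ∀ fuel k {xs v} → k ≤ v → (∀ j → k ≤ j → j < v → j ∈ˡ xs) → v ∉ˡ xs →
            v < k + fuel → mexFrom fuel k xs ≡ v
mexFrom-≡ zero k {v = v} k≤v _ _ v<k+0 = ⊥-elim (<⇒≱ (subst (v <_) (+-identityʳ k) v<k+0) k≤v)
mexFrom-≡ (suc fuel) k {xs} k≤v below v∉xs v<k+fuel with m≤n⇒m<n∨m≡n k≤v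
... | inj₂ refl with k ∈ℕ xs in eq
...   | true  = ⊥-elim (v∉xs (∈ℕ⇒∈ eq))
...   | false = refl
mexFrom-≡ (suc fuel) k {xs} {v} k≤v below v∉xs v<k+fuel | inj₁ k<v
  rewrite ∈⇒∈ℕ (below k ≤-refl k<v) =
  mexFrom-≡ fuel (suc k) k<v (λ j k<j → below j (<⇒≤ k<j)) v∉xs (subst (v <_) (+-suc k fuel) v<k+fuel)

mex-≡ : ∀ {xs} v → (∀ j → j < v → j ∈ˡ xs) → v ∉ˡ xs → mex xs ≡ v
mex-≡ {xs} v below v∉xs =
  mexFrom-≡ (suc (length xs)) 0 z≤n (λ j _ → below j) v∉xs (s≤s (below-∈⇒≤-length v xs below))

-- Subsets of Fin n

T-does⁺ : ∀ {A : Set} (a? : Dec A) → A → T (does a?)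
T-does⁺ a? a = Equivalence.from T-≡ (dec-true a? a)

T-does⁻ : ∀ {A : Set} (a? : Dec A) → T (does a?) → A
T-does⁻ a? t = toWitness (subst T (sym (isYes≗does a?)) t)

∈⇒T : ∀ {n} {x : Fin n} {p} → x ∈ p → T (x ∈ᵇ p)
∈⇒T x∈p = Equivalence.from T-≡ ([]=⇒lookup x∈p)

T⇒∈ : ∀ {n} {x : Fin n} p → T (x ∈ᵇ p) → x ∈ p
T⇒∈ {x = x} p t = lookup⇒[]= x p (Equivalence.to T-≡ t)

∈-tabulate⁺ : ∀ {n} {f : Fin n → Bool} {x} → T (f x) → x ∈ tabulate f
∈-tabulate⁺ {f = f} {x} t = lookup⇒[]= x _ (trans (lookup∘tabulate f x) (Equivalence.to T-≡ t))

∈-tabulate⁻ : ∀ {n} {f : Fin n → Bool} {x} → x ∈ tabulate f → T (f x)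
∈-tabulate⁻ {f = f} {x} x∈ = Equivalence.from T-≡ (trans (sym (lookup∘tabulate f x)) ([]=⇒lookup x∈))

⊆∧⊄⇒≡ : ∀ {n} {p q : Subset n} → p ⊆ q → ¬ p ⊂ q → p ≡ q
⊆∧⊄⇒≡ {p = p} p⊆q p⊄q = ⊆-antisym p⊆q λ {x} x∈q →
  decidable-stable (x ∈? p) λ x∉p → p⊄q (p⊆q , x , x∈q , x∉p)

∣p∪⁅x⁆∣≡1+∣p∣ : ∀ {k} (p : Subset k) {x} → x ∉ p → ∣ p ∪ ⁅ x ⁆ ∣ ≡ suc ∣ p ∣
∣p∪⁅x⁆∣≡1+∣p∣ (true  ∷ p) {Fin.zero}  x∉p = ⊥-elim (x∉p Vec.here)
∣p∪⁅x⁆∣≡1+∣p∣ (false ∷ p) {Fin.zero}  x∉p rewrite ∪-identityʳ p = refl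
∣p∪⁅x⁆∣≡1+∣p∣ (true  ∷ p) {Fin.suc x} x∉p = cong suc (∣p∪⁅x⁆∣≡1+∣p∣ p (drop-not-there x∉p))
∣p∪⁅x⁆∣≡1+∣p∣ (false ∷ p) {Fin.suc x} x∉p = ∣p∪⁅x⁆∣≡1+∣p∣ p (drop-not-there x∉p)

iterate-from-fixed : ∀ {A : Set} (f : A → A) {x} → f x ≡ x → ∀ t → iterate t f x ≡ x
iterate-from-fixed f fixed zero    = refl
iterate-from-fixed f fixed (suc t) = trans (cong f (iterate-from-fixed f fixed t)) fixed

iterate-+ : ∀ {A : Set} (f : A → A) x t j → iterate (t + j) f x ≡ iterate t f (iterate j f x)
iterate-+ f x zero    j = refl
iterate-+ f x (suc t) j = cong f (iterate-+ f x t j)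

-- An inflationary map on subsets of Fin n can grow strictly at most n times.
iterate-inflationary-fixed : ∀ {n} (f : Subset n → Subset n) → (∀ S → S ⊆ f S) →
                             ∀ S → f (iterate n f S) ≡ iterate n f S
iterate-inflationary-fixed {n} f inflationary S with growth (suc n)
  where
  growth : ∀ k → (∃ λ j → j < k × f (iterate j f S) ≡ iterate j f S) ⊎ k ≤ ∣ iterate k f S ∣
  growth zero = inj₂ z≤n
  growth (suc k) with growth k
  ... | inj₁ (j , j<k , fixed) = inj₁ (j , m≤n⇒m≤1+n j<k , fixed)
  ... | inj₂ k≤size with iterate k f S ⊂? f (iterate k f S)
  ...   | yes grows = inj₂ (<-≤-trans (s≤s k≤size) (p⊂q⇒∣p∣<∣q∣ grows))
  ...   | no stuck  = inj₁ (k , ≤-refl , sym (⊆∧⊄⇒≡ (inflationary _) stuck))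
... | inj₂ 1+n≤size = ⊥-elim (<⇒≱ 1+n≤size (∣p∣≤n (iterate (suc n) f S)))
... | inj₁ (j , s≤s j≤n , fixed) = trans (settled (suc n) (m≤n⇒m≤1+n j≤n)) (sym (settled n j≤n))
  where
  settled : ∀ k → j ≤ k → iterate k f S ≡ iterate j f S
  settled k j≤k = begin
    iterate k f S                     ≡⟨ cong (λ i → iterate i f S) (m∸n+n≡m j≤k) ⟨
    iterate (k ∸ j + j) f S           ≡⟨ iterate-+ f S (k ∸ j) j ⟩
    iterate (k ∸ j) f (iterate j f S) ≡⟨ iterate-from-fixed f fixed (k ∸ j) ⟩
    iterate j f S                     ∎
    where open ≡-Reasoning

-- gcd(n, P)

-- Opaque, as unfolding the fold during conversion checks is very expensive.
opaque
  gcdOver : ∀ {n} → Subset n → List (Fin n) → ℕ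
  gcdOver {n} P = foldr (λ x d → if x ∈ᵇ P then gcd (toℕ x) d else d) n

  gcdOf : ∀ {n} → Subset n → ℕ
  gcdOf {n} P = gcdOver P (allFin n)

  gcdOver-induction : ∀ {n} (Q : ℕ → Set) (P : Subset n) → Q n →
                      (∀ {x d} → x ∈ P → Q d → Q (gcd (toℕ x) d)) → ∀ xs → Q (gcdOver P xs)
  gcdOver-induction Q P base step [] = base
  gcdOver-induction Q P base step (x ∷ xs) with x ∈ᵇ P in x∈P
  ... | true  = step (lookup⇒[]= x P x∈P) (gcdOver-induction Q P base step xs)
  ... | false = gcdOver-induction Q P base step xs

  gcdOver-∣ : ∀ {n} {P : Subset n} {x} xs → x ∈ˡ xs → x ∈ P → gcdOver P xs ∣ toℕ x
  gcdOver-∣ (y ∷ xs) (here refl) x∈P rewrite []=⇒lookup x∈P = gcd[m,n]∣m (toℕ y) _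
  gcdOver-∣ {P = P} (y ∷ xs) (there x∈xs) x∈P with y ∈ᵇ P
  ... | true  = ∣-trans (gcd[m,n]∣n (toℕ y) _) (gcdOver-∣ xs x∈xs x∈P)
  ... | false = gcdOver-∣ xs x∈xs x∈P

  gcdOf-induction : ∀ {n} (Q : ℕ → Set) (P : Subset n) → Q n →
                    (∀ {x d} → x ∈ P → Q d → Q (gcd (toℕ x) d)) → Q (gcdOf P)
  gcdOf-induction {n} Q P base step = gcdOver-induction Q P base step (allFin n)

  gcdOf-∣ : ∀ {n} {P : Subset n} {x} → x ∈ P → gcdOf P ∣ toℕ x
  gcdOf-∣ {n} {x = x} = gcdOver-∣ (allFin n) (∈-allFin x)

gcdOf∣n : ∀ {n} (P : Subset n) → gcdOf P ∣ n
gcdOf∣n {n} P = gcdOf-induction (_∣ n) P ∣-refl λ {x} _ d∣n → ∣-trans (gcd[m,n]∣n (toℕ x) _) d∣n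

gcdOf-greatest : ∀ {n} (P : Subset n) {c} → c ∣ n → (∀ {x} → x ∈ P → c ∣ toℕ x) → c ∣ gcdOf P
gcdOf-greatest P {c} c∣n c∣P = gcdOf-induction (c ∣_) P c∣n λ x∈P c∣d → gcd-greatest (c∣P x∈P) c∣d

gcdOf≢0 : ∀ {n} .{{_ : NonZero n}} (P : Subset n) → gcdOf P ≢ 0
gcdOf≢0 {n} P d≡0 = ≢-nonZero⁻¹ n (0∣⇒≡0 (subst (_∣ n) d≡0 (gcdOf∣n P)))

gcdOf-∪⁅⁆ : ∀ {n} (P : Subset n) g → gcdOf (P ∪ ⁅ g ⁆) ≡ gcd (gcdOf P) (toℕ g)
gcdOf-∪⁅⁆ P g = ∣-antisym
  (gcd-greatest (gcdOf-greatest P (gcdOf∣n Q) λ x∈P → gcdOf-∣ (p⊆p∪q ⁅ g ⁆ x∈P))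
                (gcdOf-∣ (q⊆p∪q P ⁅ g ⁆ (x∈⁅x⁆ g))))
  (gcdOf-greatest Q (∣-trans (gcd[m,n]∣m (gcdOf P) (toℕ g)) (gcdOf∣n P))
                    λ x∈Q → ∣-element (x∈p∪q⁻ P ⁅ g ⁆ x∈Q))
  where
  Q = P ∪ ⁅ g ⁆
  ∣-element : ∀ {x} → x ∈ P ⊎ x ∈ ⁅ g ⁆ → gcd (gcdOf P) (toℕ g) ∣ toℕ x
  ∣-element (inj₁ x∈P) = ∣-trans (gcd[m,n]∣m (gcdOf P) (toℕ g)) (gcdOf-∣ x∈P)
  ∣-element (inj₂ x∈g) rewrite x∈⁅y⁆⇒x≡y g x∈g = gcd[m,n]∣n (gcdOf P) (toℕ g)

gcdOf-∪⁅⁆-∣ : ∀ {n} (P : Subset n) g → gcdOf (P ∪ ⁅ g ⁆) ∣ gcdOf P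
gcdOf-∪⁅⁆-∣ P g = subst (_∣ gcdOf P) (sym (gcdOf-∪⁅⁆ P g)) (gcd[m,n]∣m (gcdOf P) (toℕ g))

gcdOf-⊥ : ∀ {n} → gcdOf (⊥ {n}) ≡ n
gcdOf-⊥ = ∣-antisym (gcdOf∣n ⊥) (gcdOf-greatest ⊥ ∣-refl (⊥-elim ∘ ∉⊥))

-- The subgroup generated by P

module Cyclic (m : ℕ) where

  n : ℕ
  n = suc m

  private
    adds : Subset n → Fin n → Fin n → Fin n → Bool
    adds P s g p = (p ∈ᵇ P) ∧ does ((s ⊕ p) ≟ᶠ g)

    sums : Subset n → Subset n → Fin n → Fin n → Bool
    sums P S g s = (s ∈ᵇ S) ∧ any (adds P s g) elems

    stepᵇ : Subset n → Subset n → Fin n → Bool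
    stepᵇ P S g = (g ∈ᵇ S) ∨ any (sums P S g) elems

  ∈-step⁺ˡ : ∀ P {S} {x : Fin n} → x ∈ S → x ∈ step P S
  ∈-step⁺ˡ P {S} x∈S = ∈-tabulate⁺ {f = stepᵇ P S} (Equivalence.from T-∨ (inj₁ (∈⇒T x∈S)))

  ∈-step⁺ : ∀ P {S} {s p : Fin n} → s ∈ S → p ∈ P → s ⊕ p ∈ step P S
  ∈-step⁺ P {S} {s} {p} s∈S p∈P =
    ∈-tabulate⁺ {f = stepᵇ P S} (Equivalence.from (T-∨ {(s ⊕ p) ∈ᵇ S}) (inj₂ (any⁺ (sums P S (s ⊕ p))
      (lose (∈-allFin s) (Equivalence.from T-∧ (∈⇒T s∈S , any⁺ (adds P s (s ⊕ p))
        (lose (∈-allFin p) (Equivalence.from T-∧ (∈⇒T p∈P , T-does⁺ ((s ⊕ p) ≟ᶠ (s ⊕ p)) refl)))))))))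

  ∈-step⁻ : ∀ P {S} {x : Fin n} → x ∈ step P S →
            x ∈ S ⊎ ∃₂ λ s p → s ∈ S × p ∈ P × s ⊕ p ≡ x
  ∈-step⁻ P {S} {x} x∈ with Equivalence.to T-∨ (∈-tabulate⁻ {f = stepᵇ P S} x∈)
  ... | inj₁ x∈S = inj₁ (T⇒∈ S x∈S)
  ... | inj₂ some-sum with satisfied (any⁻ (sums P S x) elems some-sum)
  ... | s , t with Equivalence.to T-∧ t
  ... | s∈S , some-add with satisfied (any⁻ (adds P s x) elems some-add)
  ... | p , u with Equivalence.to T-∧ u
  ... | p∈P , s⊕p≡x = inj₂ (s , p , T⇒∈ S s∈S , T⇒∈ P p∈P , T-does⁻ ((s ⊕ p) ≟ᶠ x) s⊕p≡x)

  reach : Subset n → ℕ → Subset n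
  reach P k = iterate k (step P) ⁅ 0ᶻ ⁆

  0∈reach : ∀ P k → 0ᶻ ∈ reach P k
  0∈reach P zero    = x∈⁅x⁆ 0ᶻ
  0∈reach P (suc k) = ∈-step⁺ˡ P (0∈reach P k)

  toℕ-⊕ : (s p : Fin n) → toℕ (s ⊕ p) ≡ (toℕ s + toℕ p) % n
  toℕ-⊕ s p = toℕ-fromℕ< _

  gcdOf-∣-reach : ∀ P k {x} → x ∈ reach P k → gcdOf P ∣ toℕ x
  gcdOf-∣-reach P zero    x∈ rewrite x∈⁅y⁆⇒x≡y 0ᶻ x∈ = gcdOf P ∣0
  gcdOf-∣-reach P (suc k) x∈ with ∈-step⁻ P x∈
  ... | inj₁ x∈S = gcdOf-∣-reach P k x∈S
  ... | inj₂ (s , p , s∈S , p∈P , refl) rewrite toℕ-⊕ s p =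
    %-presˡ-∣ (∣m∣n⇒∣m+n (gcdOf-∣-reach P k s∈S) (gcdOf-∣ p∈P)) (gcdOf∣n P)

  generates⇒∈⟨⟩ : ∀ P → generates P ≡ true → ∀ x → x ∈ ⟨ P ⟩
  generates⇒∈⟨⟩ P gen x =
    T⇒∈ ⟨ P ⟩ (All.lookup (all⁺ (_∈ᵇ ⟨ P ⟩) (elems {m}) (Equivalence.from T-≡ gen)) (∈-allFin x))

  ∈⟨⟩⇒generates : ∀ P → (∀ x → x ∈ ⟨ P ⟩) → generates P ≡ true
  ∈⟨⟩⇒generates P all∈ =
    Equivalence.to T-≡ (all⁻ (_∈ᵇ ⟨ P ⟩) {elems {m}} (All.tabulate λ {x} _ → ∈⇒T (all∈ x)))

  -- gcdOf P divides both n = m + 1 and m, the latter being an element of ⟨ P ⟩.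
  generates⇒gcdOf≡1 : ∀ P → generates P ≡ true → gcdOf P ≡ 1
  generates⇒gcdOf≡1 P gen = ∣1⇒≡1 (∣m+n∣m⇒∣n (subst (gcdOf P ∣_) (+-comm 1 m) (gcdOf∣n P)) d∣m)
    where
    d∣m : gcdOf P ∣ m
    d∣m = subst (gcdOf P ∣_) (toℕ-fromℕ m) (gcdOf-∣-reach P n (generates⇒∈⟨⟩ P gen (fromℕ m)))

  ⟨⟩-closed : ∀ P {s p} → s ∈ ⟨ P ⟩ → p ∈ P → s ⊕ p ∈ ⟨ P ⟩
  ⟨⟩-closed P {s} {p} s∈ p∈P =
    subst (s ⊕ p ∈_) (iterate-inflationary-fixed (step P) (λ S → ∈-step⁺ˡ P) ⁅ 0ᶻ ⁆) (∈-step⁺ P s∈ p∈P)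

  shift : Fin n → ℕ → Fin n
  shift t a = (toℕ t + a) mod n

  toℕ-shift : ∀ t a → toℕ (shift t a) ≡ (toℕ t + a) % n
  toℕ-shift t a = toℕ-fromℕ< _

  %-absorbˡ : ∀ a b → (a % n + b) % n ≡ (a + b) % n
  %-absorbˡ a b = begin
    (a % n + b) % n           ≡⟨ %-distribˡ-+ (a % n) b n ⟩
    (a % n % n + b % n) % n   ≡⟨ cong (λ r → (r + b % n) % n) (m%n%n≡m%n a n) ⟩
    (a % n + b % n) % n       ≡⟨ %-distribˡ-+ a b n ⟨
    (a + b) % n               ∎
    where open ≡-Reasoning

  shift-+ : ∀ t a b → shift (shift t a) b ≡ shift t (a + b)
  shift-+ t a b = toℕ-injective (begin
    toℕ (shift (shift t a) b)     ≡⟨ toℕ-shift (shift t a) b ⟩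
    (toℕ (shift t a) + b) % n     ≡⟨ cong (λ r → (r + b) % n) (toℕ-shift t a) ⟩
    ((toℕ t + a) % n + b) % n     ≡⟨ %-absorbˡ (toℕ t + a) b ⟩
    (toℕ t + a + b) % n           ≡⟨ cong (_% n) (+-assoc (toℕ t) a b) ⟩
    (toℕ t + (a + b)) % n         ≡⟨ toℕ-shift t (a + b) ⟨
    toℕ (shift t (a + b))         ∎)
    where open ≡-Reasoning

  shift-multiple : ∀ t {a} → n ∣ a → shift t a ≡ t
  shift-multiple t n∣a = toℕ-injective
    (trans (toℕ-shift t _) (trans (%-remove-+ʳ (toℕ t) n∣a) (m<n⇒m%n≡m (toℕ<n t))))

  ShiftInvariant : Subset n → ℕ → Set
  ShiftInvariant S a = ∀ {t} → t ∈ S → shift t a ∈ S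

  module _ {S : Subset n} where

    invariant-+ : ∀ {a b} → ShiftInvariant S a → ShiftInvariant S b → ShiftInvariant S (a + b)
    invariant-+ {a} {b} inv-a inv-b {t} t∈S = subst (_∈ S) (shift-+ t a b) (inv-b (inv-a t∈S))

    invariant-multiple : ∀ {a} → n ∣ a → ShiftInvariant S a
    invariant-multiple n∣a {t} t∈S = subst (_∈ S) (sym (shift-multiple t n∣a)) t∈S

    invariant-* : ∀ k {a} → ShiftInvariant S a → ShiftInvariant S (k * a)
    invariant-* zero    inv-a = invariant-multiple (n ∣0)
    invariant-* (suc k) inv-a = invariant-+ inv-a (invariant-* k inv-a)

    -- Shifting by a + b and then m more times by b is shifting by a + n·b, i.e. by a.
    invariant-∸ : ∀ {a b} → ShiftInvariant S (a + b) → ShiftInvariant S b → ShiftInvariant S a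
    invariant-∸ {a} {b} inv-a+b inv-b {t} t∈S = subst (_∈ S) shifted (inv-a+b+mb t∈S)
      where
      inv-a+b+mb : ShiftInvariant S (a + b + m * b)
      inv-a+b+mb = invariant-+ inv-a+b (invariant-* m inv-b)
      shifted : shift t (a + b + m * b) ≡ shift t a
      shifted = begin
        shift t (a + b + m * b)     ≡⟨ cong (shift t) (+-assoc a b (m * b)) ⟩
        shift t (a + n * b)         ≡⟨ shift-+ t a (n * b) ⟨
        shift (shift t a) (n * b)   ≡⟨ shift-multiple (shift t a) (m∣m*n b) ⟩
        shift t a                   ∎
        where open ≡-Reasoning

    invariant-gcd : ∀ {a b} → ShiftInvariant S a → ShiftInvariant S b → ShiftInvariant S (gcd a b)
    invariant-gcd {a} {b} inv-a inv-b with Bézout.identity (gcd-GCD a b)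
    ... | Bézout.+- x y eq =
      invariant-∸ (subst (ShiftInvariant S) (sym eq) (invariant-* x inv-a)) (invariant-* y inv-b)
    ... | Bézout.-+ x y eq =
      invariant-∸ (subst (ShiftInvariant S) (sym eq) (invariant-* y inv-b)) (invariant-* x inv-a)

    invariant-1⇒⊤ : 0ᶻ ∈ S → ShiftInvariant S 1 → ∀ x → x ∈ S
    invariant-1⇒⊤ 0∈S inv-1 x = subst (_∈ S) (toℕ-injective toℕ-x-mod) (multiples (toℕ x))
      where
      multiples : ∀ k → k mod n ∈ S
      multiples zero    = 0∈S
      multiples (suc k) = subst (_∈ S) (toℕ-injective (begin
        toℕ (shift (k mod n) 1)   ≡⟨ toℕ-shift (k mod n) 1 ⟩
        (toℕ (k mod n) + 1) % n   ≡⟨ cong (λ r → (r + 1) % n) (toℕ-fromℕ< (m%n<n k n)) ⟩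
        (k % n + 1) % n           ≡⟨ %-absorbˡ k 1 ⟩
        (k + 1) % n               ≡⟨ cong (_% n) (+-comm k 1) ⟩
        suc k % n                 ≡⟨ toℕ-fromℕ< (m%n<n (suc k) n) ⟨
        toℕ (suc k mod n)         ∎)) (inv-1 (multiples k))
        where open ≡-Reasoning
      toℕ-x-mod : toℕ (toℕ x mod n) ≡ toℕ x
      toℕ-x-mod = trans (toℕ-fromℕ< (m%n<n (toℕ x) n)) (m<n⇒m%n≡m (toℕ<n x))

  gcdOf≡1⇒generates : ∀ P → gcdOf P ≡ 1 → generates P ≡ true
  gcdOf≡1⇒generates P gcd≡1 = ∈⟨⟩⇒generates P (invariant-1⇒⊤ (0∈reach P n) inv-1)
    where
    inv-gcdOf : ShiftInvariant ⟨ P ⟩ (gcdOf P)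
    inv-gcdOf = gcdOf-induction (ShiftInvariant ⟨ P ⟩) P (invariant-multiple ∣-refl)
      λ p∈P → invariant-gcd (λ s∈ → ⟨⟩-closed P s∈ p∈P)
    inv-1 : ShiftInvariant ⟨ P ⟩ 1
    inv-1 = subst (ShiftInvariant ⟨ P ⟩) gcd≡1 inv-gcdOf

-- Counting multiples

∣tabulate∣-+ : ∀ k l (h : ℕ → Bool) →
               ∣ tabulate {n = k + l} (h ∘ toℕ) ∣ ≡
               ∣ tabulate {n = k} (h ∘ toℕ) ∣ + ∣ tabulate {n = l} (λ i → h (k + toℕ i)) ∣
∣tabulate∣-+ zero    l h = refl
∣tabulate∣-+ (suc k) l h with h 0
... | true  = cong suc (∣tabulate∣-+ k l (h ∘ suc))
... | false = ∣tabulate∣-+ k l (h ∘ suc)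

∣tabulate∣≡0 : ∀ {k} (f : Fin k → Bool) → (∀ x → f x ≡ false) → ∣ tabulate f ∣ ≡ 0
∣tabulate∣≡0 {zero}  f none = refl
∣tabulate∣≡0 {suc k} f none rewrite none Fin.zero = ∣tabulate∣≡0 (f ∘ Fin.suc) (none ∘ Fin.suc)

multiplesOf : ∀ {k} → ℕ → Subset k
multiplesOf e = tabulate λ x → does (e ∣? toℕ x)

∣multiplesOf∣ : ∀ {k} e q .{{_ : NonZero e}} → k ≡ q * e → ∣ multiplesOf {k} e ∣ ≡ q
∣multiplesOf∣ e zero    refl = refl
∣multiplesOf∣ e@(suc e-1) (suc q) refl = begin
  ∣ tabulate {n = e + q * e} (h ∘ toℕ) ∣
    ≡⟨ ∣tabulate∣-+ e (q * e) h ⟩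
  ∣ tabulate {n = e} (h ∘ toℕ) ∣ + ∣ tabulate {n = q * e} (λ i → h (e + toℕ i)) ∣
    ≡⟨ cong₂ _+_ one-block (cong ∣_∣ (tabulate-cong periodic)) ⟩
  1 + ∣ multiplesOf {q * e} e ∣
    ≡⟨ cong suc (∣multiplesOf∣ e q refl) ⟩
  suc q
    ∎
  where
  open ≡-Reasoning
  h : ℕ → Bool
  h i = does (e ∣? i)
  periodic : ∀ (i : Fin (q * e)) → h (e + toℕ i) ≡ h (toℕ i)
  periodic i = does-⇔ (mk⇔ (λ e∣e+i → ∣m+n∣m⇒∣n e∣e+i ∣-refl) (∣m∣n⇒∣m+n ∣-refl)) (e ∣? _) (e ∣? _)
  one-block : ∣ tabulate {n = e} (h ∘ toℕ) ∣ ≡ 1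
  one-block rewrite dec-true (e ∣? 0) (e ∣0) =
    cong suc (∣tabulate∣≡0 (λ (x : Fin e-1) → h (suc (toℕ x))) λ x →
      dec-false (e ∣? suc (toℕ x)) λ e∣ → <⇒≱ (s≤s (toℕ<n x)) (∣⇒≤ e∣))

multiple∉ : ∀ {k} (P : Subset k) e q .{{_ : NonZero e}} → k ≡ q * e →
            (∀ {x} → x ∈ P → e ∣ toℕ x) → ∣ P ∣ ≢ q → ∃ λ g → g ∉ P × e ∣ toℕ g
multiple∉ P e q k≡qe P⊆e ∣P∣≢q with P ⊂? multiplesOf e
... | yes (_ , g , g∈M , g∉P) = g , g∉P , T-does⁻ (e ∣? toℕ g) (∈-tabulate⁻ g∈M)
... | no  P⊄M = ⊥-elim (∣P∣≢q (trans (cong ∣_∣ (⊆∧⊄⇒≡ P⊆M P⊄M)) (∣multiplesOf∣ e q k≡qe)))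
  where
  P⊆M : P ⊆ multiplesOf e
  P⊆M {x} x∈P = ∈-tabulate⁺ (T-does⁺ (e ∣? toℕ x) (P⊆e x∈P))

-- Parity

parity-suc : ∀ k → parity (suc k) ≡ parity k ⁻¹
parity-suc k = trans (sym (⁻¹-involutive (parity (suc k)))) (cong _⁻¹ (suc-homo-⁻¹ k))

parity≡0ℙ⇒2∣ : ∀ a → parity a ≡ 0ℙ → 2 ∣ a
parity≡0ℙ⇒2∣ zero          _    = 2 ∣0
parity≡0ℙ⇒2∣ (suc (suc a)) even = ∣m∣n⇒∣m+n ∣-refl (parity≡0ℙ⇒2∣ a even)

2∣⇒parity≡0ℙ : ∀ {a} → 2 ∣ a → parity a ≡ 0ℙ
2∣⇒parity≡0ℙ (divides q refl) rewrite *-homo-* q 2 with parity q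
... | 0ℙ = refl
... | 1ℙ = refl

parity-even≢odd : ∀ {a b} → parity a ≡ 0ℙ → parity b ≡ 1ℙ → a ≢ b
parity-even≢odd a-even b-odd a≡b with trans (sym a-even) (trans (cong parity a≡b) b-odd)
... | ()

parity-*-odd : ∀ a b → parity (a * b) ≡ 1ℙ → parity a ≡ 1ℙ × parity b ≡ 1ℙ
parity-*-odd a b odd rewrite *-homo-* a b with parity a | parity b | odd
... | 1ℙ | 1ℙ | _ = refl , refl

parity-*-even : ∀ a b → parity (a * b) ≡ 0ℙ → parity a ≡ 1ℙ → parity b ≡ 0ℙ
parity-*-even a b even a-odd rewrite *-homo-* a b | a-odd = even

parity-∣-odd : ∀ {a b} → a ∣ b → parity b ≡ 1ℙ → parity a ≡ 1ℙ
parity-∣-odd {a} a∣b b-odd with parity a in a-parity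
... | 1ℙ = refl
... | 0ℙ with trans (sym (2∣⇒parity≡0ℙ (∣-trans (parity≡0ℙ⇒2∣ a a-parity) a∣b))) b-odd
...   | ()

parity-%2 : ∀ k → k % 2 ≡ 1 → parity k ≡ 1ℙ
parity-%2 k k%2≡1 with parity k in k-parity
... | 1ℙ = refl
... | 0ℙ with trans (sym k%2≡1) (n∣m⇒m%n≡0 k 2 (parity≡0ℙ⇒2∣ k k-parity))
...   | ()

%4≡0-half : ∀ k → k % 4 ≡ 0 → Σ ℕ λ h → k ≡ h * 2 × parity h ≡ 0ℙ
%4≡0-half k k%4≡0 with m%n≡0⇒n∣m k 4 k%4≡0
... | divides t k≡t*4 = t * 2 , trans k≡t*4 (sym (*-assoc t 2 2)) , 2∣⇒parity≡0ℙ (n∣m*n t)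

module _ {k : ℕ} (k%4≡2 : k % 4 ≡ 2) where

  parity-%4≡2 : parity k ≡ 0ℙ
  parity-%4≡2 = 2∣⇒parity≡0ℙ (∣n∣m%n⇒∣m {m = k} (divides 2 refl) (subst (2 ∣_) (sym k%4≡2) ∣-refl))

  %4≡2-odd-factor : ∀ a b → k ≡ a * b → parity a ≡ 0ℙ → parity b ≡ 1ℙ
  %4≡2-odd-factor a b k≡ab a-even with parity b in b-parity
  ... | 1ℙ = refl
  ... | 0ℙ with trans (sym k%4≡2) (n∣m⇒m%n≡0 k 4 (subst (4 ∣_) (sym k≡ab)
                  (*-pres-∣ (parity≡0ℙ⇒2∣ a a-even) (parity≡0ℙ⇒2∣ b b-parity))))
  ...   | ()

byParity : ℕ → ℕ → Parity → ℕ
byParity a b 0ℙ = a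
byParity a b 1ℙ = b

byParity-≢0 : ∀ {a b} → a ≢ 0 → b ≢ 0 → ∀ p → byParity a b p ≢ 0
byParity-≢0 a≢0 b≢0 0ℙ = a≢0
byParity-≢0 a≢0 b≢0 1ℙ = b≢0

byParity-flip : ∀ {a b} → a ≢ b → ∀ p → byParity a b (p ⁻¹) ≢ byParity a b p
byParity-flip a≢b 0ℙ = a≢b ∘ sym
byParity-flip a≢b 1ℙ = a≢b

-- The class of gcd(n, P) for n ≡ 2 (mod 4): two means 2, odd means odd, and large means
-- even and larger than 2.
data Class : Set where
  two odd large : Class

classOf : ℕ → Class
classOf d with d ≟ 2 | parity d
... | yes _ | _  = two
... | no  _ | 0ℙ = large
... | no  _ | 1ℙ = odd

classOf≡two⇒ : ∀ d → classOf d ≡ two → d ≡ 2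
classOf≡two⇒ d c≡ with d ≟ 2 | parity d
classOf≡two⇒ d c≡ | yes d≡2 | _  = d≡2
classOf≡two⇒ d () | no  _   | 0ℙ
classOf≡two⇒ d () | no  _   | 1ℙ

classOf≡odd⇒ : ∀ d → classOf d ≡ odd → parity d ≡ 1ℙ
classOf≡odd⇒ d c≡ with d ≟ 2 | parity d
classOf≡odd⇒ d () | yes _ | _
classOf≡odd⇒ d () | no  _ | 0ℙ
classOf≡odd⇒ d c≡ | no  _ | 1ℙ = refl

classOf≡large⇒ : ∀ d → classOf d ≡ large → d ≢ 2 × parity d ≡ 0ℙ
classOf≡large⇒ d c≡ with d ≟ 2 | parity d
classOf≡large⇒ d () | yes _   | _
classOf≡large⇒ d c≡ | no  d≢2 | 0ℙ = d≢2 , refl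
classOf≡large⇒ d () | no  _   | 1ℙ

classOf-odd : ∀ d → parity d ≡ 1ℙ → classOf d ≡ odd
classOf-odd d d-odd with d ≟ 2
classOf-odd _ ()    | yes refl
classOf-odd d d-odd | no _ with parity d
classOf-odd d ()    | no _ | 0ℙ
classOf-odd d d-odd | no _ | 1ℙ = refl

classOf-large : ∀ d → d ≢ 2 → parity d ≡ 0ℙ → classOf d ≡ large
classOf-large d d≢2 d-even with d ≟ 2
... | yes d≡2 = ⊥-elim (d≢2 d≡2)
... | no  _ with parity d
classOf-large d d≢2 d-even | no _ | 0ℙ = refl
classOf-large d d≢2 ()     | no _ | 1ℙ

divisor-of-2 : ∀ {d} → d ∣ 2 → d ≢ 1 → d ≡ 2
divisor-of-2 {0} 0∣2 _ with 0∣⇒≡0 0∣2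
... | ()
divisor-of-2 {1} _ 1≢1 = ⊥-elim (1≢1 refl)
divisor-of-2 {2} _ _   = refl
divisor-of-2 {suc (suc (suc d))} d∣2 _ with ∣⇒≤ d∣2
... | s≤s (s≤s ())

classOf-∣ : ∀ {d d′} → d′ ∣ d → d′ ≢ 1 → classOf d ≡ large ⊎ classOf d′ ≡ classOf d
classOf-∣ {d} {d′} d′∣d d′≢1 with classOf d in c≡
... | large = inj₁ refl
... | two   = inj₂ (cong classOf (divisor-of-2 (subst (d′ ∣_) (classOf≡two⇒ d c≡) d′∣d) d′≢1))
... | odd   = inj₂ (classOf-odd d′ (parity-∣-odd d′∣d (classOf≡odd⇒ d c≡)))

classValue : Class → Parity → ℕ
classValue two   = byParity 2 1
classValue odd   = byParity 1 2
classValue large = byParity 4 3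

classValue-≢0 : ∀ c p → classValue c p ≢ 0
classValue-≢0 two   = byParity-≢0 (λ ()) (λ ())
classValue-≢0 odd   = byParity-≢0 (λ ()) (λ ())
classValue-≢0 large = byParity-≢0 (λ ()) (λ ())

classValue-changes : ∀ c c′ p → c ≡ large ⊎ c′ ≡ c → classValue c′ (p ⁻¹) ≢ classValue c p
classValue-changes two   _     p  (inj₂ refl) = byParity-flip (λ ()) p
classValue-changes odd   _     p  (inj₂ refl) = byParity-flip (λ ()) p
classValue-changes large large p  _           = byParity-flip (λ ()) p
classValue-changes large two   0ℙ _           = λ ()
classValue-changes large two   1ℙ _           = λ ()
classValue-changes large odd   0ℙ _           = λ ()
classValue-changes large odd   1ℙ _           = λ ()

-- Nim-numbers from a valuation

module Game (m : ℕ) where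

  open Cyclic (suc m) public

  one : Fin n
  one = Fin.suc Fin.zero

  gcdOf≢1⇒one∉ : ∀ (P : Subset n) → gcdOf P ≢ 1 → one ∉ P
  gcdOf≢1⇒one∉ P ≢1 one∈P = ≢1 (∣1⇒≡1 (gcdOf-∣ one∈P))

  gcdOf-∪⁅one⁆ : ∀ (P : Subset n) → gcdOf (P ∪ ⁅ one ⁆) ≡ 1
  gcdOf-∪⁅one⁆ P = trans (gcdOf-∪⁅⁆ P one) (gcd-zeroʳ (gcdOf P))

  generates≡false : ∀ (P : Subset n) → gcdOf P ≢ 1 → generates P ≡ false
  generates≡false P ≢1 = ¬-not (≢1 ∘ generates⇒gcdOf≡1 P)

  options : ℕ → Subset n → List ℕ
  options f P = map (λ g → nimF f (P ∪ ⁅ g ⁆)) (lfilter (λ g → ¬? ((g ∈ᵇ P) Bool.≟ true)) elems)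

  nimF-generating : ∀ f (Q : Subset n) → gcdOf Q ≡ 1 → nimF f Q ≡ 0
  nimF-generating zero    Q _  = refl
  nimF-generating (suc f) Q ≡1 = cong (if_then 0 else mex (options f Q)) (gcdOf≡1⇒generates Q ≡1)

  ∈-options⁺ : ∀ f (P : Subset n) {g} → g ∉ P → nimF f (P ∪ ⁅ g ⁆) ∈ˡ options f P
  ∈-options⁺ f P {g} g∉P = ∈-map⁺ (λ g → nimF f (P ∪ ⁅ g ⁆))
    (∈-filter⁺ (λ g → ¬? ((g ∈ᵇ P) Bool.≟ true)) (∈-allFin g) (λ g∈P → g∉P (lookup⇒[]= g P g∈P)))

  ∈-options⁻ : ∀ f (P : Subset n) {v} → v ∈ˡ options f P → ∃ λ g → g ∉ P × v ≡ nimF f (P ∪ ⁅ g ⁆)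
  ∈-options⁻ f P v∈ with ∈-map⁻ (λ g → nimF f (P ∪ ⁅ g ⁆)) v∈
  ... | g , g∈ , v≡ with ∈-filter⁻ (λ g → ¬? ((g ∈ᵇ P) Bool.≟ true)) g∈
  ...   | _ , g∉P = g , (λ g∈P → g∉P ([]=⇒lookup g∈P)) , v≡

  -- A candidate for the nim-numbers of the non-terminal positions, those with gcdOf P ≢ 1.
  record Valuation : Set where
    field
      value         : Subset n → ℕ
      value≢0       : ∀ (P : Subset n) → gcdOf P ≢ 1 → value P ≢ 0
      value-changes : ∀ (P : Subset n) {g} → gcdOf P ≢ 1 → g ∉ P → gcdOf (P ∪ ⁅ g ⁆) ≢ 1 →
                      value (P ∪ ⁅ g ⁆) ≢ value P
      value-reaches : ∀ (P : Subset n) j → gcdOf P ≢ 1 → 0 < j → j < value P →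
                      ∃ λ g → g ∉ P × gcdOf (P ∪ ⁅ g ⁆) ≢ 1 × value (P ∪ ⁅ g ⁆) ≡ j

  module _ (V : Valuation) where
    open Valuation V

    nimF≡value : ∀ f (P : Subset n) → f + ∣ P ∣ ≡ n → gcdOf P ≢ 1 → nimF f P ≡ value P
    nimF≡value zero    P ∣P∣≡n ≢1 =
      ⊥-elim (gcdOf≢1⇒one∉ P ≢1 (subst (one ∈_) (sym (∣p∣≡n⇒p≡⊤ ∣P∣≡n)) ∈⊤))
    nimF≡value (suc f) P fuel  ≢1 =
      trans (cong (if_then 0 else mex (options f P)) (generates≡false P ≢1)) (mex-≡ (value P) below value∉)
      where
      fuel′ : ∀ {g} → g ∉ P → f + ∣ P ∪ ⁅ g ⁆ ∣ ≡ n
      fuel′ g∉P = trans (cong (f +_) (∣p∪⁅x⁆∣≡1+∣p∣ P g∉P)) (trans (+-suc f ∣ P ∣) fuel)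

      below : ∀ j → j < value P → j ∈ˡ options f P
      below zero    _ = subst (_∈ˡ options f P) (nimF-generating f _ (gcdOf-∪⁅one⁆ P))
                          (∈-options⁺ f P (gcdOf≢1⇒one∉ P ≢1))
      below (suc j) j<v with value-reaches P (suc j) ≢1 (s≤s z≤n) j<v
      ... | g , g∉P , ≢1′ , v≡j = subst (_∈ˡ options f P)
                                    (trans (nimF≡value f _ (fuel′ g∉P) ≢1′) v≡j) (∈-options⁺ f P g∉P)

      value∉ : value P ∉ˡ options f P
      value∉ v∈ with ∈-options⁻ f P v∈
      ... | g , g∉P , v≡ with gcdOf (P ∪ ⁅ g ⁆) ≟ 1
      ...   | yes ≡1  = value≢0 P ≢1 (trans v≡ (nimF-generating f _ ≡1))
      ...   | no  ≢1′ = value-changes P ≢1 g∉P ≢1′ (sym (trans v≡ (nimF≡value f _ (fuel′ g∉P) ≢1′)))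

  -- Stated with n unfolded, so that it matches nimGEN without evaluating the game.
  nimGEN≡value : (V : Valuation) → nimGEN (suc (suc m)) ≡ Valuation.value V (⊥ {suc (suc m)})
  nimGEN≡value V = nimF≡value V (suc (suc m)) ⊥ (trans (cong (n +_) (∣⊥∣≡0 n)) (+-identityʳ n)) n≢1
    where
    n≢1 : gcdOf (⊥ {n}) ≢ 1
    n≢1 d≡1 with trans (sym gcdOf-⊥) d≡1
    ... | ()

  order : Subset n → ℕ
  order P = _∣_.quotient (gcdOf∣n P)

  n≡order*gcdOf : ∀ (P : Subset n) → n ≡ order P * gcdOf P
  n≡order*gcdOf P = _∣_.equality (gcdOf∣n P)

  move-within : ∀ (P : Subset n) e q .{{_ : NonZero e}} → n ≡ q * e → e ∣ gcdOf P → ∣ P ∣ ≢ q →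
                ∃ λ g → g ∉ P × e ∣ gcdOf (P ∪ ⁅ g ⁆)
  move-within P e q n≡qe e∣d ∣P∣≢q =
    let g , g∉P , e∣g = multiple∉ P e q n≡qe (λ x∈P → ∣-trans e∣d (gcdOf-∣ x∈P)) ∣P∣≢q
    in  g , g∉P , subst (e ∣_) (sym (gcdOf-∪⁅⁆ P g)) (gcd-greatest e∣d e∣g)

  move-keeping-gcdOf : ∀ (P : Subset n) → ∣ P ∣ ≢ order P → ∃ λ g → g ∉ P × gcdOf (P ∪ ⁅ g ⁆) ≡ gcdOf P
  move-keeping-gcdOf P ∣P∣≢q =
    let g , g∉P , d∣d′ =
          move-within P (gcdOf P) (order P) ⦃ ≢-nonZero (gcdOf≢0 P) ⦄ (n≡order*gcdOf P) ∣-refl ∣P∣≢q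
    in  g , g∉P , ∣-antisym (gcdOf-∪⁅⁆-∣ P g) d∣d′

  add-divisor : ∀ (P : Subset n) {c} → c ∣ gcdOf P → 0 < c → c < gcdOf P →
                ∃ λ g → g ∉ P × gcdOf (P ∪ ⁅ g ⁆) ≡ c
  add-divisor P {c} c∣d 0<c c<d = g , g∉P , d′≡c
    where
    c<n : c < n
    c<n = <-≤-trans c<d (∣⇒≤ (gcdOf∣n P))
    g : Fin n
    g = Fin.fromℕ< c<n
    g∉P : g ∉ P
    g∉P g∈P = <⇒≱ c<d (∣⇒≤ ⦃ >-nonZero 0<c ⦄ (subst (gcdOf P ∣_) (toℕ-fromℕ< c<n) (gcdOf-∣ g∈P)))
    d′≡c : gcdOf (P ∪ ⁅ g ⁆) ≡ c
    d′≡c = begin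
      gcdOf (P ∪ ⁅ g ⁆)      ≡⟨ gcdOf-∪⁅⁆ P g ⟩
      gcd (gcdOf P) (toℕ g)  ≡⟨ cong (gcd (gcdOf P)) (toℕ-fromℕ< c<n) ⟩
      gcd (gcdOf P) c        ≡⟨ ∣-antisym (gcd[m,n]∣n (gcdOf P) c) (gcd-greatest c∣d ∣-refl) ⟩
      c                      ∎
      where open ≡-Reasoning

  parity-∣∪⁅⁆∣ : ∀ (P : Subset n) {g} → g ∉ P → parity ∣ P ∪ ⁅ g ⁆ ∣ ≡ parity ∣ P ∣ ⁻¹
  parity-∣∪⁅⁆∣ P g∉P = trans (cong parity (∣p∪⁅x⁆∣≡1+∣p∣ P g∉P)) (parity-suc ∣ P ∣)

  byParity-∪⁅⁆ : ∀ a b (P : Subset n) {g p} → g ∉ P → parity ∣ P ∣ ≡ p →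
                 byParity a b (parity ∣ P ∪ ⁅ g ⁆ ∣) ≡ byParity a b (p ⁻¹)
  byParity-∪⁅⁆ a b P g∉P refl = cong (byParity a b) (parity-∣∪⁅⁆∣ P g∉P)

  -- n odd

  module _ (n-odd : parity n ≡ 1ℙ) where

    value-odd : Subset n → ℕ
    value-odd P = byParity 2 1 (parity ∣ P ∣)

    value-odd-reaches : ∀ (P : Subset n) j → gcdOf P ≢ 1 → 0 < j → j < value-odd P →
                        ∃ λ g → g ∉ P × gcdOf (P ∪ ⁅ g ⁆) ≢ 1 × value-odd (P ∪ ⁅ g ⁆) ≡ j
    value-odd-reaches P j ≢1 _ j<v with parity ∣ P ∣ in ∣P∣-parity
    value-odd-reaches P 1 ≢1 _ _ | 0ℙ =
      let g , g∉P , d′≡d = move-keeping-gcdOf P (parity-even≢odd ∣P∣-parity order-odd)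
      in  g , g∉P , subst (_≢ 1) (sym d′≡d) ≢1 , byParity-∪⁅⁆ 2 1 P g∉P ∣P∣-parity
      where
      order-odd : parity (order P) ≡ 1ℙ
      order-odd = proj₁ (parity-*-odd (order P) (gcdOf P)
                    (trans (cong parity (sym (n≡order*gcdOf P))) n-odd))
    value-odd-reaches P (suc (suc j)) _ _ (s≤s (s≤s ())) | 0ℙ
    value-odd-reaches P (suc j)       _ _ (s≤s ())       | 1ℙ

    valuation-odd : Valuation
    valuation-odd = record
      { value         = value-odd
      ; value≢0       = λ P _ → byParity-≢0 (λ ()) (λ ()) (parity ∣ P ∣)
      ; value-changes = λ P _ g∉P _ → subst (_≢ value-odd P) (sym (byParity-∪⁅⁆ 2 1 P g∉P refl))
                                        (byParity-flip (λ ()) (parity ∣ P ∣))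
      ; value-reaches = value-odd-reaches
      }

    nimGEN-odd : nimGEN (suc (suc m)) ≡ 2
    nimGEN-odd = trans (nimGEN≡value valuation-odd) (cong (byParity 2 1 ∘ parity) (∣⊥∣≡0 n))

  -- n ≡ 0 (mod 4)

  module _ {h} (n≡h*2 : n ≡ h * 2) (h-even : parity h ≡ 0ℙ) where

    value-0mod4 : Subset n → ℕ
    value-0mod4 P = byParity 1 2 (parity ∣ P ∣)

    -- If ⟨P⟩ has odd order then gcdOf P is even, and the move stays inside the even residues.
    value-0mod4-reaches : ∀ (P : Subset n) j → gcdOf P ≢ 1 → 0 < j → j < value-0mod4 P →
                          ∃ λ g → g ∉ P × gcdOf (P ∪ ⁅ g ⁆) ≢ 1 × value-0mod4 (P ∪ ⁅ g ⁆) ≡ j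
    value-0mod4-reaches P j ≢1 _ j<v with parity ∣ P ∣ in ∣P∣-parity | parity (order P) in q-parity
    value-0mod4-reaches P 1 ≢1 _ _ | 1ℙ | 0ℙ =
      let g , g∉P , d′≡d = move-keeping-gcdOf P (≢-sym (parity-even≢odd q-parity ∣P∣-parity))
      in  g , g∉P , subst (_≢ 1) (sym d′≡d) ≢1 , byParity-∪⁅⁆ 1 2 P g∉P ∣P∣-parity
    value-0mod4-reaches P 1 ≢1 _ _ | 1ℙ | 1ℙ =
      let g , g∉P , 2∣d′ = move-within P 2 h n≡h*2 2∣d (≢-sym (parity-even≢odd h-even ∣P∣-parity))
      in  g , g∉P , even≢1 2∣d′ , byParity-∪⁅⁆ 1 2 P g∉P ∣P∣-parity
      where
      even≢1 : ∀ {x} → 2 ∣ x → x ≢ 1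
      even≢1 2∣x refl with ∣1⇒≡1 2∣x
      ... | ()
      2∣d : 2 ∣ gcdOf P
      2∣d = parity≡0ℙ⇒2∣ (gcdOf P) (parity-*-even (order P) (gcdOf P)
              (trans (cong parity (sym (n≡order*gcdOf P))) (2∣⇒parity≡0ℙ (divides h n≡h*2))) q-parity)
    value-0mod4-reaches P (suc (suc j)) _ _ (s≤s (s≤s ())) | 1ℙ | _
    value-0mod4-reaches P (suc j)       _ _ (s≤s ())       | 0ℙ | _

    valuation-0mod4 : Valuation
    valuation-0mod4 = record
      { value         = value-0mod4
      ; value≢0       = λ P _ → byParity-≢0 (λ ()) (λ ()) (parity ∣ P ∣)
      ; value-changes = λ P _ g∉P _ → subst (_≢ value-0mod4 P) (sym (byParity-∪⁅⁆ 1 2 P g∉P refl))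
                                        (byParity-flip (λ ()) (parity ∣ P ∣))
      ; value-reaches = value-0mod4-reaches
      }

    nimGEN-0mod4 : nimGEN (suc (suc m)) ≡ 1
    nimGEN-0mod4 = trans (nimGEN≡value valuation-0mod4) (cong (byParity 1 2 ∘ parity) (∣⊥∣≡0 n))

  -- n ≡ 2 (mod 4)

  module _ (n%4≡2 : n % 4 ≡ 2) where

    value-2mod4 : Subset n → ℕ
    value-2mod4 P = classValue (classOf (gcdOf P)) (parity ∣ P ∣)

    Move : Subset n → Class → Set
    Move P c = ∃ λ g → g ∉ P × gcdOf (P ∪ ⁅ g ⁆) ≢ 1 × classOf (gcdOf (P ∪ ⁅ g ⁆)) ≡ c

    move-reaches : ∀ (P : Subset n) {c p} → Move P c → parity ∣ P ∣ ≡ p →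
                   ∃ λ g → g ∉ P × gcdOf (P ∪ ⁅ g ⁆) ≢ 1 × value-2mod4 (P ∪ ⁅ g ⁆) ≡ classValue c (p ⁻¹)
    move-reaches P (g , g∉P , ≢1 , refl) refl =
      g , g∉P , ≢1 , cong (classValue (classOf (gcdOf (P ∪ ⁅ g ⁆)))) (parity-∣∪⁅⁆∣ P g∉P)

    move-keeping-class : ∀ (P : Subset n) {c} → classOf (gcdOf P) ≡ c → gcdOf P ≢ 1 → ∣ P ∣ ≢ order P →
                         Move P c
    move-keeping-class P c≡ ≢1 ∣P∣≢q =
      let g , g∉P , d′≡d = move-keeping-gcdOf P ∣P∣≢q
      in  g , g∉P , subst (_≢ 1) (sym d′≡d) ≢1 , trans (cong classOf d′≡d) c≡

    order-odd : ∀ (P : Subset n) → parity (gcdOf P) ≡ 0ℙ → parity (order P) ≡ 1ℙ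
    order-odd P = %4≡2-odd-factor n%4≡2 (gcdOf P) (order P)
                    (trans (n≡order*gcdOf P) (*-comm (order P) (gcdOf P)))

    order-even : ∀ (P : Subset n) → parity (gcdOf P) ≡ 1ℙ → parity (order P) ≡ 0ℙ
    order-even P = parity-*-even (gcdOf P) (order P)
      (trans (cong parity (trans (*-comm (gcdOf P) (order P)) (sym (n≡order*gcdOf P))))
             (parity-%4≡2 {n} n%4≡2))

    -- With gcdOf P = 2k for some odd k > 1, adding 2 or k reaches the classes two and odd.
    module Large (P : Subset n) (large : classOf (gcdOf P) ≡ large) where

      d : ℕ
      d = gcdOf P

      2∣d : 2 ∣ d
      2∣d = parity≡0ℙ⇒2∣ d (proj₂ (classOf≡large⇒ d large))

      k : ℕ
      k = _∣_.quotient 2∣d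

      d≡k*2 : d ≡ k * 2
      d≡k*2 = _∣_.equality 2∣d

      k-odd : parity k ≡ 1ℙ
      k-odd = proj₂ (parity-*-odd (order P) k (%4≡2-odd-factor n%4≡2 2 (order P * k) n≡2*qk refl))
        where
        n≡2*qk : n ≡ 2 * (order P * k)
        n≡2*qk = begin
          n                    ≡⟨ n≡order*gcdOf P ⟩
          order P * d          ≡⟨ cong (order P *_) d≡k*2 ⟩
          order P * (k * 2)    ≡⟨ *-assoc (order P) k 2 ⟨
          order P * k * 2      ≡⟨ *-comm (order P * k) 2 ⟩
          2 * (order P * k)    ∎
          where open ≡-Reasoning

      k≢0 : k ≢ 0
      k≢0 k≡0 = gcdOf≢0 P (trans d≡k*2 (cong (_* 2) k≡0))

      k≢1 : k ≢ 1
      k≢1 k≡1 = proj₁ (classOf≡large⇒ d large) (trans d≡k*2 (cong (_* 2) k≡1))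

      to-two : Move P two
      to-two =
        let g , g∉P , d′≡2 = add-divisor P 2∣d (s≤s z≤n) 2<d
        in  g , g∉P , subst (_≢ 1) (sym d′≡2) (λ ()) , cong classOf d′≡2
        where
        2<d : 2 < d
        2<d = ≤∧≢⇒< (∣⇒≤ ⦃ ≢-nonZero (gcdOf≢0 P) ⦄ 2∣d) (≢-sym (proj₁ (classOf≡large⇒ d large)))

      to-odd : Move P odd
      to-odd =
        let g , g∉P , d′≡k = add-divisor P k∣d (n≢0⇒n>0 k≢0) k<d
        in  g , g∉P , subst (_≢ 1) (sym d′≡k) k≢1 , trans (cong classOf d′≡k) (classOf-odd k k-odd)
        where
        k∣d : k ∣ d
        k∣d = divides 2 (trans d≡k*2 (*-comm k 2))
        k<d : k < d
        k<d = subst (k <_) (sym d≡k*2) (m<m*n k 2 ⦃ ≢-nonZero k≢0 ⦄ ≤-refl)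

    value-2mod4-reaches : ∀ (P : Subset n) j → gcdOf P ≢ 1 → 0 < j → j < value-2mod4 P →
                          ∃ λ g → g ∉ P × gcdOf (P ∪ ⁅ g ⁆) ≢ 1 × value-2mod4 (P ∪ ⁅ g ⁆) ≡ j
    value-2mod4-reaches P j ≢1 _ j<v with classOf (gcdOf P) in c≡ | parity ∣ P ∣ in p≡
    value-2mod4-reaches P 1 ≢1 _ _ | two   | 0ℙ = move-reaches P (move-keeping-class P c≡ ≢1 ∣P∣≢q) p≡
      where
      ∣P∣≢q : ∣ P ∣ ≢ order P
      ∣P∣≢q = parity-even≢odd p≡ (order-odd P (cong parity (classOf≡two⇒ (gcdOf P) c≡)))
    value-2mod4-reaches P 1 ≢1 _ _ | odd   | 1ℙ = move-reaches P (move-keeping-class P c≡ ≢1 ∣P∣≢q) p≡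
      where
      ∣P∣≢q : ∣ P ∣ ≢ order P
      ∣P∣≢q = ≢-sym (parity-even≢odd (order-even P (classOf≡odd⇒ (gcdOf P) c≡)) p≡)
    value-2mod4-reaches P 1 ≢1 _ _ | large | 0ℙ = move-reaches P (Large.to-two P c≡) p≡
    value-2mod4-reaches P 2 ≢1 _ _ | large | 0ℙ = move-reaches P (Large.to-odd P c≡) p≡
    value-2mod4-reaches P 3 ≢1 _ _ | large | 0ℙ = move-reaches P (move-keeping-class P c≡ ≢1 ∣P∣≢q) p≡
      where
      ∣P∣≢q : ∣ P ∣ ≢ order P
      ∣P∣≢q = parity-even≢odd p≡ (order-odd P (proj₂ (classOf≡large⇒ (gcdOf P) c≡)))
    value-2mod4-reaches P 1 ≢1 _ _ | large | 1ℙ = move-reaches P (Large.to-odd P c≡) p≡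
    value-2mod4-reaches P 2 ≢1 _ _ | large | 1ℙ = move-reaches P (Large.to-two P c≡) p≡
    value-2mod4-reaches P (suc (suc j))             _ _ (s≤s (s≤s ()))             | two   | 0ℙ
    value-2mod4-reaches P (suc j)                   _ _ (s≤s ())                   | two   | 1ℙ
    value-2mod4-reaches P (suc j)                   _ _ (s≤s ())                   | odd   | 0ℙ
    value-2mod4-reaches P (suc (suc j))             _ _ (s≤s (s≤s ()))             | odd   | 1ℙ
    value-2mod4-reaches P (suc (suc (suc (suc j)))) _ _ (s≤s (s≤s (s≤s (s≤s ())))) | large | 0ℙ
    value-2mod4-reaches P (suc (suc (suc j)))       _ _ (s≤s (s≤s (s≤s ())))       | large | 1ℙ

    valuation-2mod4 : Valuation
    valuation-2mod4 = record
      { value         = value-2mod4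
      ; value≢0       = λ P _ → classValue-≢0 (classOf (gcdOf P)) (parity ∣ P ∣)
      ; value-changes = λ P {g} _ g∉P d′≢1 →
          subst (_≢ value-2mod4 P)
            (sym (cong (classValue (classOf (gcdOf (P ∪ ⁅ g ⁆)))) (parity-∣∪⁅⁆∣ P g∉P)))
            (classValue-changes (classOf (gcdOf P)) (classOf (gcdOf (P ∪ ⁅ g ⁆))) (parity ∣ P ∣)
              (classOf-∣ (gcdOf-∪⁅⁆-∣ P g) d′≢1))
      ; value-reaches = value-2mod4-reaches
      }

    nimGEN-2mod4 : n ≢ 2 → nimGEN (suc (suc m)) ≡ 4
    nimGEN-2mod4 n≢2 = trans (nimGEN≡value valuation-2mod4)
      (cong₂ classValue (trans (cong classOf gcdOf-⊥) (classOf-large n n≢2 (parity-%4≡2 {n} n%4≡2)))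
                        (cong parity (∣⊥∣≡0 n)))

corollary6p9 : (nimGEN 2 ≡ 2)
    × (∀ (n : ℕ) → 3 ≤ n →
         (n % 2 ≡ 1 → nimGEN n ≡ 2)
       × (n % 4 ≡ 0 → nimGEN n ≡ 1)
       × (n % 4 ≡ 2 → nimGEN n ≡ 4))
corollary6p9 = refl , λ where
  (suc (suc (suc k))) (s≤s (s≤s (s≤s _))) → let open Game (suc k) in
      (λ n%2≡1 → nimGEN-odd (parity-%2 n n%2≡1))
    , (λ n%4≡0 → let h , n≡h*2 , h-even = %4≡0-half n n%4≡0 in nimGEN-0mod4 {h} n≡h*2 h-even)
    , (λ n%4≡2 → nimGEN-2mod4 n%4≡2 λ ())
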